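{- Let $n$ be a positive integer and $S=(1,s_2,\ldots)$ a packing sequence. (i) If $n$ is even, then $\chi_S(P_{n+1})=\chi_S(P_n)$. (ii) If $S'=(1,s_2',\ldots)$ is a packing sequence such that $s_i'\in\{2\lceil (s_i+1)/2\rceil-1,\ s_i\}$ for every $i\ge 2$, then $\chi_{S'}(P_n)=\chi_S(P_n)$.
   Context: A packing sequence is a non-decreasing infinite sequence $S=(s_1,s_2,\ldots)$ of positive integers. For a graph $G$, a map $\phi\colon V(G)\to\{1,\ldots,k\}$ is an $S$-packing $k$-coloring if any two distinct vertices $u,v$ with $\phi(u)=\phi(v)=i$ satisfy $d_G(u,v) > s_i$; $\chi_S(G)$ is the least such $k$. $P_n$ is the path on $n$ vertices. -}

module Defs where

open import Data.Nat using (ℕ; zero; suc; _+_; _*_; _∸_; _≤_; _<_; ⌈_/2⌉; ∣_-_∣)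
open import Data.Fin using (Fin; toℕ)
open import Data.Product using (_×_; Σ)
open import Relation.Binary.PropositionalEquality using (_≡_; _≢_)
open import Relation.Nullary using (¬_)

-- A sequence s : ℕ → ℕ is read 1-indexed via  s_i = s (i ∸ 1)  for i ≥ 1,
-- i.e. s 0 = s_1, s 1 = s_2, ...  Colours are Fin k; colour c ∈ Fin k is
-- the paper's colour toℕ c + 1 and must respect distance > s (toℕ c).

record PackingSequence (s : ℕ → ℕ) : Set where
  field
    positive     : ∀ i → 1 ≤ s i
    nondecreasing : ∀ i j → i ≤ j → s i ≤ s j

distP : {n : ℕ} → Fin n → Fin n → ℕ
distP u v = ∣ toℕ u - toℕ v ∣

IsPackingColouring : (s : ℕ → ℕ) (n k : ℕ) → (Fin n → Fin k) → Set
IsPackingColouring s n k φ =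
  ∀ (u v : Fin n) → u ≢ v → φ u ≡ φ v → s (toℕ (φ u)) < distP u v

PackingColourable : (s : ℕ → ℕ) (n k : ℕ) → Set
PackingColourable s n k = Σ (Fin n → Fin k) (IsPackingColouring s n k)

IsPackingChromatic : (s : ℕ → ℕ) (n k : ℕ) → Set
IsPackingChromatic s n k =
  PackingColourable s n k × (∀ m → m < k → ¬ PackingColourable s n m)

roundOdd : ℕ → ℕ
roundOdd x = 2 * ⌈ (x + 1) /2⌉ ∸ 1

{-# OPTIONS --safe #-}
-- Since s₁ = 1, no two adjacent vertices share the colour zero, so the vertices
-- with a nonzero colour form a sequence v₀ < v₁ < … with v₀ ≤ 1 and gaps of at
-- most 2; hence vₜ ≤ 2t + 1 and |v_a − v_b| ≤ 2|a − b|. Giving vertex 2t + 1 the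
-- colour of vₜ and every even vertex the colour zero yields a packing colouring
-- of any path with no more odd vertices, in which equal nonzero colours sit at
-- even distance 2|a − b| ≥ |v_a − v_b| > s_c. An even number exceeding s_c also exceeds
-- the least odd number ≥ s_c, which gives (ii); for even n, P_{n+1} has as many
-- odd vertices as P_n, which gives (i).
module Submission where

open import Defs
open import Data.Nat using (ℕ; zero; suc; _+_; _*_; _∸_; _≤_; _<_; z≤n; s≤s; s≤s⁻¹; ∣_-_∣; ⌊_/2⌋)
open import Data.Nat.Properties hiding (_≟_)
open import Data.Fin using (Fin; toℕ; fromℕ<; inject≤; _≟_)
  renaming (zero to fzero)
open import Data.Fin.Properties using (toℕ<n; toℕ-injective; toℕ-fromℕ<; fromℕ<-injective; toℕ-inject≤; inject≤-injective)
open import Data.Product using (_×_; ∃; _,_)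
open import Data.Sum using (_⊎_; inj₁; inj₂)
open import Function using (_∘_; id)
open import Function.Bundles using (_⇔_; mk⇔; Equivalence)
open import Relation.Binary.Consequences using (wlog)
open import Relation.Binary.Definitions using (tri<; tri≈; tri>)
open import Relation.Binary.PropositionalEquality
open import Relation.Nullary using (¬_; yes; no; contradiction)
open import Relation.Unary using (Decidable)

module _ {f : ℕ → ℕ} (f-< : ∀ t → f t < f (suc t)) where

  increasing-< : ∀ {a b} → a < b → f a < f b
  increasing-< {a} {suc b} (s≤s a≤b) with m≤n⇒m<n∨m≡n a≤b
  ... | inj₁ a<b  = <-trans (increasing-< a<b) (f-< b)
  ... | inj₂ refl = f-< a

  increasing-injective : ∀ {a b} → a ≢ b → f a ≢ f b
  increasing-injective {a} {b} a≢b with <-cmp a b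
  ... | tri< a<b _ _ = <⇒≢ (increasing-< a<b)
  ... | tri≈ _ a≡b _ = contradiction a≡b a≢b
  ... | tri> _ _ b<a = >⇒≢ (increasing-< b<a)

module _ (f : ℕ → ℕ) {L : ℕ} (f-step : ∀ t → ∣ f t - f (suc t) ∣ ≤ L) where

  lipschitz-+ : ∀ a e → ∣ f a - f (e + a) ∣ ≤ L * e
  lipschitz-+ a zero = subst (_≤ L * 0) (sym (∣n-n∣≡0 (f a))) z≤n
  lipschitz-+ a (suc e) = begin
    ∣ f a - f (suc e + a) ∣                               ≤⟨ ∣-∣-triangle (f a) (f (e + a)) _ ⟩
    ∣ f a - f (e + a) ∣ + ∣ f (e + a) - f (suc e + a) ∣  ≤⟨ +-mono-≤ (lipschitz-+ a e) (f-step (e + a)) ⟩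
    L * e + L                                             ≡⟨ +-comm (L * e) L ⟩
    L + L * e                                             ≡⟨ *-suc L e ⟨
    L * suc e                                             ∎
    where open ≤-Reasoning

  lipschitz : ∀ a b → ∣ f a - f b ∣ ≤ L * ∣ a - b ∣
  lipschitz = wlog ≤-total swap upward
    where
    swap : ∀ {a b} → ∣ f a - f b ∣ ≤ L * ∣ a - b ∣ → ∣ f b - f a ∣ ≤ L * ∣ b - a ∣
    swap {a} {b} = subst₂ _≤_ (∣-∣-comm (f a) (f b)) (cong (L *_) (∣-∣-comm a b))
    upward : ∀ a b → a ≤ b → ∣ f a - f b ∣ ≤ L * ∣ a - b ∣
    upward a b a≤b =
      subst₂ (λ c d → ∣ f a - f c ∣ ≤ L * d) (m∸n+n≡m a≤b) (sym (m≤n⇒∣m-n∣≡n∸m a≤b))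
        (lipschitz-+ a (b ∸ a))

-- walk enumerates the positions outside P as long as P contains no two consecutive positions.
module Avoiding {P : ℕ → Set} (P? : Decidable P) where

  avoid : ℕ → ℕ
  avoid j with P? j
  ... | yes _ = suc j
  ... | no _  = j

  avoid-≥ : ∀ j → j ≤ avoid j
  avoid-≥ j with P? j
  ... | yes _ = n≤1+n j
  ... | no _  = ≤-refl

  avoid-≤ : ∀ j → avoid j ≤ suc j
  avoid-≤ j with P? j
  ... | yes _ = ≤-refl
  ... | no _  = n≤1+n j

  avoid-∉ : ∀ {j} → (P j → ¬ P (suc j)) → ¬ P (avoid j)
  avoid-∉ {j} sparse with P? j
  ... | yes p  = sparse p
  ... | no ¬p  = ¬p

  walk : ℕ → ℕ
  walk zero    = avoid 0
  walk (suc t) = avoid (suc (walk t))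

  walk-< : ∀ t → walk t < walk (suc t)
  walk-< t = avoid-≥ (suc (walk t))

  walk-step : ∀ t → ∣ walk t - walk (suc t) ∣ ≤ 2
  walk-step t = begin
    ∣ walk t - walk (suc t) ∣  ≡⟨ m≤n⇒∣m-n∣≡n∸m (<⇒≤ (walk-< t)) ⟩
    walk (suc t) ∸ walk t      ≤⟨ m≤n+o⇒m∸n≤o (walk (suc t)) (walk t) walk-suc≤ ⟩
    2                          ∎
    where
    open ≤-Reasoning
    walk-suc≤ : walk (suc t) ≤ walk t + 2
    walk-suc≤ = subst (walk (suc t) ≤_) (+-comm 2 (walk t)) (avoid-≤ (suc (walk t)))

  walk-≤ : ∀ t → walk t ≤ suc (2 * t)

  2+walk-≤ : ∀ t → 2 + walk t ≤ suc (2 * suc t)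
  2+walk-≤ t = subst (2 + walk t ≤_) (cong suc (sym (*-suc 2 t))) (+-monoʳ-≤ 2 (walk-≤ t))

  walk-≤ zero    = avoid-≤ 0
  walk-≤ (suc t) = ≤-trans (avoid-≤ (suc (walk t))) (2+walk-≤ t)

  walk-∉ : ∀ {n} → (∀ j → suc j < n → P j → ¬ P (suc j)) →
           ∀ {t} → suc (2 * t) < n → ¬ P (walk t)
  walk-∉ sparse {zero}  1<n   = avoid-∉ (sparse 0 1<n)
  walk-∉ sparse {suc t} bound = avoid-∉ (sparse (suc (walk t)) (≤-<-trans (2+walk-≤ t) bound))

IsPackingColouringℕ : (s : ℕ → ℕ) (n : ℕ) {k : ℕ} → (ℕ → Fin k) → Set
IsPackingColouringℕ s n φ =
  ∀ {i j} → i < n → j < n → i ≢ j → φ i ≡ φ j → s (toℕ (φ i)) < ∣ i - j ∣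

colouringℕ⇒colouring : ∀ {s n k} {φ : ℕ → Fin k} →
  IsPackingColouringℕ s n φ → IsPackingColouring s n k (φ ∘ toℕ)
colouringℕ⇒colouring φ-ok u v u≢v = φ-ok (toℕ<n u) (toℕ<n v) (u≢v ∘ toℕ-injective)

extend : ∀ {n k} → (Fin n → Fin (suc k)) → ℕ → Fin (suc k)
extend {n} φ i with i <? n
... | yes i<n = φ (fromℕ< i<n)
... | no _    = fzero

extend-fromℕ< : ∀ {n k} (φ : Fin n → Fin (suc k)) {i} (i<n : i < n) → extend φ i ≡ φ (fromℕ< i<n)
extend-fromℕ< {n} φ {i} i<n with i <? n
... | yes _     = refl
... | no i≮n   = contradiction i<n i≮n

extend-colouring : ∀ {s n k} {φ : Fin n → Fin (suc k)} →
  IsPackingColouring s n (suc k) φ → IsPackingColouringℕ s n (extend φ)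
extend-colouring {s} {φ = φ} φ-ok {i} {j} i<n j<n i≢j same
  rewrite extend-fromℕ< φ i<n | extend-fromℕ< φ j<n =
  subst (s _ <_) (cong₂ ∣_-_∣ (toℕ-fromℕ< i<n) (toℕ-fromℕ< j<n))
    (φ-ok _ _ (i≢j ∘ fromℕ<-injective i j i<n j<n) same)

data EvenOdd : ℕ → Set where
  even : ∀ a → EvenOdd (2 * a)
  odd  : ∀ a → EvenOdd (suc (2 * a))

evenOdd : ∀ i → EvenOdd i
evenOdd zero = even 0
evenOdd (suc i) with evenOdd i
... | even a = odd a
... | odd a  = subst EvenOdd (*-suc 2 a) (even (suc a))

spread : ∀ {k} → (ℕ → Fin (suc k)) → ℕ → Fin (suc k)
spread c i with evenOdd i
... | even _ = fzero
... | odd a  = c a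

spread-colouring : ∀ {s N k} {c : ℕ → Fin (suc k)} → s 0 ≤ 1 →
  (∀ {a} → suc (2 * a) < N → c a ≢ fzero) →
  (∀ {a b} → suc (2 * a) < N → suc (2 * b) < N → a ≢ b → c a ≡ c b →
     s (toℕ (c a)) < 2 * ∣ a - b ∣) →
  IsPackingColouringℕ s N (spread c)
spread-colouring {s} s₀≤1 nonzero packing {i} {j} i<N j<N i≢j same
  with evenOdd i | evenOdd j
... | even a | even b = subst (s 0 <_) (*-distribˡ-∣-∣ 2 a b)
        (≤-trans (s≤s s₀≤1) (*-monoʳ-≤ 2 (n≢0⇒n>0 (a≢b ∘ ∣m-n∣≡0⇒m≡n))))
  where
  a≢b : a ≢ b
  a≢b = i≢j ∘ cong (2 *_)
... | even _ | odd _  = contradiction (sym same) (nonzero j<N)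
... | odd _  | even _ = contradiction same (nonzero i<N)
... | odd a  | odd b  = subst (s _ <_) (*-distribˡ-∣-∣ 2 a b)
        (packing i<N j<N (i≢j ∘ cong (suc ∘ (2 *_))) same)

module Skipping {s n k} {φ : ℕ → Fin (suc k)} (1≤s₀ : 1 ≤ s 0) (φ-ok : IsPackingColouringℕ s n φ) where

  open Avoiding (λ j → φ j ≟ fzero)

  zeros-nonadjacent : ∀ j → suc j < n → φ j ≡ fzero → φ (suc j) ≢ fzero
  zeros-nonadjacent j 1+j<n φj≡0 φ1+j≡0 = ≤⇒≯ 1≤s₀
    (subst₂ _<_ (cong (s ∘ toℕ) φj≡0) ∣j-1+j∣≡1
      (φ-ok (<-trans (n<1+n j) 1+j<n) 1+j<n (<⇒≢ (n<1+n j)) (trans φj≡0 (sym φ1+j≡0))))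
    where
    ∣j-1+j∣≡1 : ∣ j - suc j ∣ ≡ 1
    ∣j-1+j∣≡1 = trans (m≤n⇒∣m-n∣≡n∸m (n≤1+n j)) (m+n∸n≡m 1 j)

  skipped : ℕ → Fin (suc k)
  skipped = φ ∘ walk

  skipped-nonzero : ∀ {t} → suc (2 * t) < n → skipped t ≢ fzero
  skipped-nonzero {t} = walk-∉ zeros-nonadjacent {t}

  skipped-packing : ∀ {a b} → suc (2 * a) < n → suc (2 * b) < n → a ≢ b →
    skipped a ≡ skipped b → s (toℕ (skipped a)) < 2 * ∣ a - b ∣
  skipped-packing {a} {b} a<n b<n a≢b same = <-≤-trans
    (φ-ok (≤-<-trans (walk-≤ a) a<n) (≤-<-trans (walk-≤ b) b<n) (increasing-injective walk-< a≢b) same)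
    (lipschitz walk walk-step a b)

colourable-normalise : ∀ {s s′ n N k} → 1 ≤ s 0 → s′ 0 ≤ 1 →
  (∀ c d → s c < 2 * d → s′ c < 2 * d) → 1 ≤ n →
  (∀ t → suc (2 * t) < N → suc (2 * t) < n) →
  PackingColourable s n k → PackingColourable s′ N k
colourable-normalise {k = zero} _ _ _ 1≤n _ (φ , _) with φ (fromℕ< 1≤n)
... | ()
colourable-normalise {s} {s′} {k = suc k} 1≤s₀ s′₀≤1 even-below 1≤n odd-below (φ , φ-ok) =
  spread skipped ∘ toℕ ,
  colouringℕ⇒colouring {s′} (spread-colouring {s′} s′₀≤1
    (λ {a} a<N → skipped-nonzero {a} (odd-below a a<N))
    (λ {a} {b} a<N b<N a≢b same →
      even-below _ ∣ a - b ∣ (skipped-packing {a} {b} (odd-below a a<N) (odd-below b b<N) a≢b same)))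
  where open Skipping {s} 1≤s₀ (extend-colouring {s} φ-ok)

colourable-restrict : ∀ {s N M k} → N ≤ M → PackingColourable s M k → PackingColourable s N k
colourable-restrict {s} {N} {M} N≤M (φ , φ-ok) = φ ∘ embed , λ u v u≢v same →
  subst (s _ <_) (cong₂ ∣_-_∣ (toℕ-inject≤ u N≤M) (toℕ-inject≤ v N≤M))
    (φ-ok (embed u) (embed v) (u≢v ∘ inject≤-injective N≤M N≤M u v) same)
  where
  embed : Fin N → Fin M
  embed u = inject≤ u N≤M

colourable-relax : ∀ {s s′ n k} → (∀ c → s c ≤ s′ c) →
  PackingColourable s′ n k → PackingColourable s n k
colourable-relax s≤s′ (φ , φ-ok) = φ , λ u v u≢v same → ≤-<-trans (s≤s′ _) (φ-ok u v u≢v same)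

chromatic-transfer : ∀ {s s′ n n′ k} →
  (∀ m → PackingColourable s n m → PackingColourable s′ n′ m) →
  (∀ m → PackingColourable s′ n′ m → PackingColourable s n m) →
  IsPackingChromatic s n k → IsPackingChromatic s′ n′ k
chromatic-transfer to from (colourable , least) =
  to _ colourable , λ m m<k colourable′ → least m m<k (from m colourable′)

chromatic-cong : ∀ {s s′ n n′} →
  (∀ m → PackingColourable s n m ⇔ PackingColourable s′ n′ m) →
  ∀ k → IsPackingChromatic s n k ⇔ IsPackingChromatic s′ n′ k
chromatic-cong {s} {s′} same k =
  mk⇔ (chromatic-transfer {s} {s′} (to ∘ same) (from ∘ same))
      (chromatic-transfer {s′} {s} (from ∘ same) (to ∘ same))
  where open Equivalence

roundOdd-+2 : ∀ x → roundOdd (2 + x) ≡ 2 + roundOdd x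
roundOdd-+2 x rewrite +-comm x 1 = cong suc (+-suc ⌊ x /2⌋ _)

≤roundOdd : ∀ x → x ≤ roundOdd x
≤roundOdd 0             = z≤n
≤roundOdd 1             = ≤-refl
≤roundOdd (suc (suc x)) = subst (2 + x ≤_) (sym (roundOdd-+2 x)) (+-monoʳ-≤ 2 (≤roundOdd x))

roundOdd<2* : ∀ x d → x < 2 * d → roundOdd x < 2 * d
roundOdd<2* x (suc d) x<2+2d rewrite *-suc 2 d with x
... | 0           = s≤s (s≤s z≤n)
... | 1           = s≤s (s≤s z≤n)
... | suc (suc y) rewrite roundOdd-+2 y =
  +-monoʳ-≤ 2 (roundOdd<2* y d (s≤s⁻¹ (s≤s⁻¹ x<2+2d)))

rounded-≥ : ∀ {x y} → y ≡ roundOdd x ⊎ y ≡ x → x ≤ y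
rounded-≥ {x} (inj₁ refl) = ≤roundOdd x
rounded-≥     (inj₂ refl) = ≤-refl

rounded-<2* : ∀ {x y} → y ≡ roundOdd x ⊎ y ≡ x → ∀ d → x < 2 * d → y < 2 * d
rounded-<2* {x} (inj₁ refl) d = roundOdd<2* x d
rounded-<2*     (inj₂ refl) _ = id

odd<2m+1⇒odd<2m : ∀ m t → suc (2 * t) < 2 * m + 1 → suc (2 * t) < 2 * m
odd<2m+1⇒odd<2m m t bound = subst (_≤ 2 * m) (*-suc 2 t) (*-monoʳ-≤ 2 t<m)
  where
  t<m : t < m
  t<m = *-cancelˡ-< 2 t m (s≤s⁻¹ (subst (suc (2 * t) <_) (+-comm (2 * m) 1) bound))

even-path-chromatic : ∀ s → s 0 ≡ 1 → ∀ {n} → 1 ≤ n → (∃ λ m → n ≡ 2 * m) →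
  ∀ k → IsPackingChromatic s (n + 1) k ⇔ IsPackingChromatic s n k
even-path-chromatic s s₀≡1 {n} 1≤n (m , refl) = chromatic-cong {s} {s} λ k →
  mk⇔ (colourable-restrict {s} (m≤m+n n 1))
      (colourable-normalise {s} {s} (≤-reflexive (sym s₀≡1)) (≤-reflexive s₀≡1) (λ _ _ → id) 1≤n
         (odd<2m+1⇒odd<2m m))

rounded-chromatic : ∀ s s′ → s 0 ≡ 1 → s′ 0 ≡ 1 →
  (∀ i → 1 ≤ i → s′ i ≡ roundOdd (s i) ⊎ s′ i ≡ s i) →
  ∀ {n} → 1 ≤ n → ∀ k → IsPackingChromatic s′ n k ⇔ IsPackingChromatic s n k
rounded-chromatic s s′ s₀≡1 s′₀≡1 rounded 1≤n = chromatic-cong {s′} {s} λ k →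
  mk⇔ (colourable-relax {s} {s′} (λ c → rounded-≥ (choice c)))
      (colourable-normalise {s} {s′} (≤-reflexive (sym s₀≡1)) (≤-reflexive s′₀≡1)
         (λ c → rounded-<2* (choice c)) 1≤n (λ _ → id))
  where
  choice : ∀ c → s′ c ≡ roundOdd (s c) ⊎ s′ c ≡ s c
  choice zero    = inj₂ (trans s′₀≡1 (sym s₀≡1))
  choice (suc c) = rounded (suc c) (s≤s z≤n)

lemma2p2 : ∀ (s : ℕ → ℕ) → PackingSequence s → s 0 ≡ 1 → ∀ (n : ℕ) → 1 ≤ n →
    ((∃ λ m → n ≡ 2 * m) → ∀ k → IsPackingChromatic s (n + 1) k ⇔ IsPackingChromatic s n k)
    × (∀ (s′ : ℕ → ℕ) → PackingSequence s′ → s′ 0 ≡ 1 →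
        (∀ i → 1 ≤ i → (s′ i ≡ roundOdd (s i)) ⊎ (s′ i ≡ s i)) →
        ∀ k → IsPackingChromatic s′ n k ⇔ IsPackingChromatic s n k)
lemma2p2 s _ s₀≡1 n 1≤n =
  even-path-chromatic s s₀≡1 1≤n ,
  λ s′ _ s′₀≡1 rounded → rounded-chromatic s s′ s₀≡1 s′₀≡1 rounded 1≤n
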